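{- Let $\mathcal{H}=\bigcup_{i\in[t]}\bigcup_{j\in[\ell_i]}P_{i,j}$ be a coarse ear-decomposition in a graph $G$ and let $v$ be a vertex of $\mathcal{H}$. Then (i) $\deg_{\mathcal{H}}(v)=3$ if and only if there exists a unique pair $(i,j)$ with $i\in[t]$, $j\in[\ell_i]$, $j\ge2$, such that $v\in\{a_{i,j},b_{i,j}\}$; and (ii) $\deg_{\mathcal{H}}(v)=4$ if and only if there exists a unique $i\in[t]$ such that $P_{i,1}$ is of type 1 and $v=c_i$.
   Context: Graphs are finite and simple; $[i]=\{1,\dots,i\}$. For $S\subseteq V(G)$ and $r\ge0$, $B_G(S,r)$ is the set of vertices at distance at most $r$ from $S$ in $G$. $V_{\ge3}(G)$ is the set of vertices of degree at least $3$ in $G$. For a subgraph $H$ of $G$, an $H$-path is a path in $G$ of length at least $1$ whose ends lie in $V(H)$, whose internal vertices are not in $V(H)$, and which shares no edge with $H$. Coarse ear-decomposition: for positive integers $t,\ell_1,\dots,\ell_t$, a subgraph $\mathcal{H}=\bigcup_{i\in[t]}\bigcup_{j\in[\ell_i]}P_{i,j}$ of $G$ such that, with $H_{0,0}$ the null graph, $\ell_0=0$, $Y_{0,0}=Z_{0,0}=\emptyset$, and for $i\in[t],j\in[\ell_i]$: $H_{i,j}=\bigl(\bigcup_{p\in[i-1]}\bigcup_{q\in[\ell_p]}P_{p,q}\bigr)\cup\bigcup_{r\in[j]}P_{i,r}$, $Y_{i,j}=B_{H_{i,j}}(V_{\ge3}(H_{i,j}),2)$, $Z_{i,j}=B_{G-(V(H_{i,j})\setminus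 Y_{i,j})}(Y_{i,j},1)$, the following hold. (A) For each $i\in[t]$, $G-Z_{i-1,\ell_{i-1}}$ has no $H_{i-1,\ell_{i-1}}$-path. (B) For each $i\in[t]$: if $G-Z_{i-1,\ell_{i-1}}$ has a cycle meeting $V(H_{i-1,\ell_{i-1}})$ in exactly one vertex, then $P_{i,1}$ is a shortest such cycle (type 1), and $c_i$ denotes that vertex; otherwise $P_{i,1}$ is a shortest cycle of $G-Z_{i-1,\ell_{i-1}}$ (type 2). (C) For each $i\in[t]$ and $j\in[\ell_i]\setminus\{1\}$, $P_{i,j}$ is a shortest $H_{i,j-1}$-path of $G-Z_{i,j-1}$, with ends $a_{i,j},b_{i,j}$. -}

module Defs where

open import Data.Nat using (ℕ; zero; suc; _+_; _∸_; _≤_)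
open import Data.Fin using (Fin; _≟_)
open import Data.Bool using (Bool; true; false; _∧_; _∨_; T; if_then_else_)
open import Data.List using (List; []; _∷_; _++_; map; concatMap; upTo; allFin; length)
open import Data.Bool.ListAction using (any)
open import Data.Nat.ListAction using (sum)
open import Data.List.Membership.Propositional using (_∈_)
open import Data.List.Relation.Unary.Any using (Any)
open import Data.List.Relation.Unary.All using (All)
open import Data.List.Relation.Unary.Unique.Propositional using (Unique)
open import Data.Product using (Σ; ∃; _×_; _,_)
open import Data.Sum using (_⊎_)
open import Relation.Nullary using (¬_; does)
open import Relation.Binary.PropositionalEquality using (_≡_)

record Graph (n : ℕ) : Set where
  field
    adj    : Fin n → Fin n → Bool
    sym    : ∀ u v → adj u v ≡ adj v u
    irrefl : ∀ v → adj v v ≡ false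
open Graph public

record GView (n : ℕ) : Set₁ where
  field
    Vtx : Fin n → Set
    Edg : Fin n → Fin n → Set
open GView public

_minus_ : ∀ {n} → Graph n → (Fin n → Set) → GView n
G minus X = record
  { Vtx = λ v → ¬ X v
  ; Edg = λ u v → T (adj G u v) × ¬ X u × ¬ X v }

data Walk {n} (Γ : GView n) : Fin n → Fin n → ℕ → Set where
  nil  : ∀ {u} → Vtx Γ u → Walk Γ u u 0
  cons : ∀ {u w v k} → Vtx Γ u → Edg Γ u w → Walk Γ w v k → Walk Γ u v (suc k)

Ball : ∀ {n} → GView n → (Fin n → Set) → ℕ → Fin n → Set
Ball Γ S r v = Σ _ λ s → S s × Σ ℕ λ k → k ≤ r × Walk Γ s v k

-- Ears, given as vertex sequences.  A path v0 … vk (k ≥ 1) is the list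
-- [v0, …, vk]; a cycle is the list [v0, …, v(k-1), v0] (k ≥ 3).
-- A subgraph built from ears is a list of ears (its union).

Ear : ℕ → Set
Ear n = List (Fin n)

data Consec {n} : Ear n → Fin n → Fin n → Set where
  here  : ∀ {x y xs} → Consec (x ∷ y ∷ xs) x y
  there : ∀ {x xs u v} → Consec xs u v → Consec (x ∷ xs) u v

consecB : ∀ {n} → Ear n → Fin n → Fin n → Bool
consecB (x ∷ y ∷ xs) u v = (does (x ≟ u) ∧ does (y ≟ v)) ∨ consecB (y ∷ xs) u v
consecB _ u v = false

earLen : ∀ {n} → Ear n → ℕ
earLen p = length p ∸ 1

edgeB : ∀ {n} → List (Ear n) → Fin n → Fin n → Bool
edgeB H u v = any (λ p → consecB p u v ∨ consecB p v u) H

VtxH : ∀ {n} → List (Ear n) → Fin n → Set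
VtxH H v = Any (v ∈_) H

EdgeH : ∀ {n} → List (Ear n) → Fin n → Fin n → Set
EdgeH H u v = T (edgeB H u v)

viewH : ∀ {n} → List (Ear n) → GView n
viewH H = record { Vtx = VtxH H ; Edg = EdgeH H }

deg : ∀ {n} → List (Ear n) → Fin n → ℕ
deg {n} H v = sum (map (λ u → if edgeB H v u then 1 else 0) (allFin n))

V≥3 : ∀ {n} → List (Ear n) → Fin n → Set
V≥3 H v = 3 ≤ deg H v

Yset : ∀ {n} → List (Ear n) → Fin n → Set
Yset H = Ball (viewH H) (V≥3 H) 2

Zset : ∀ {n} → Graph n → List (Ear n) → Fin n → Set
Zset G H = Ball (G minus (λ v → VtxH H v × ¬ Yset H v)) (Yset H) 1

PathEnds : ∀ {n} → Ear n → Fin n → Fin n → Ear n → Set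
PathEnds p a b mid = p ≡ a ∷ (mid ++ b ∷ [])

IsPath : ∀ {n} → GView n → Ear n → Set
IsPath Γ p = Unique p × All (Vtx Γ) p × (∀ {u v} → Consec p u v → Edg Γ u v)

IsCycle : ∀ {n} → GView n → Ear n → Set
IsCycle Γ c = Σ _ λ x → Σ _ λ mid → c ≡ x ∷ (mid ++ x ∷ []) × 2 ≤ length mid
  × Unique (x ∷ mid) × All (Vtx Γ) c × (∀ {u v} → Consec c u v → Edg Γ u v)

HPath : ∀ {n} → GView n → List (Ear n) → Fin n → Fin n → Ear n → Set
HPath Γ H a b p = IsPath Γ p × Σ _ λ mid → PathEnds p a b mid
  × VtxH H a × VtxH H b × All (λ x → ¬ VtxH H x) mid
  × (∀ {u v} → Consec p u v → ¬ EdgeH H u v)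

MeetsOnceAt : ∀ {n} → List (Ear n) → Ear n → Fin n → Set
MeetsOnceAt H c x = x ∈ c × VtxH H x × (∀ y → y ∈ c → VtxH H y → y ≡ x)

IsEnd : ∀ {n} → Ear n → Fin n → Set
IsEnd p v = (Σ _ λ b → Σ _ λ mid → PathEnds p v b mid)
          ⊎ (Σ _ λ a → Σ _ λ mid → PathEnds p a v mid)

-- Coarse ear-decompositions.  Indices are 1-based natural numbers as in
-- the paper: ears P i j for 1 ≤ i ≤ t, 1 ≤ j ≤ ℓ i (other values unused).

range1 : ℕ → List ℕ
range1 j = map suc (upTo j)

module _ {n : ℕ} (ℓ : ℕ → ℕ) (P : ℕ → ℕ → Ear n) where

  stage : ℕ → ℕ → List (Ear n)
  stage i j = map (P i) (range1 j)

  -- H_{i-1,ℓ_{i-1}} : all ears of stages 1, …, i-1 (null graph for i = 1)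
  Hbefore : ℕ → List (Ear n)
  Hbefore i = concatMap (λ p → stage p (ℓ p)) (range1 (i ∸ 1))

  Hij : ℕ → ℕ → List (Ear n)
  Hij i j = Hbefore i ++ stage i j

module _ {n : ℕ} (G : Graph n) (ℓ : ℕ → ℕ) (P : ℕ → ℕ → Ear n) where

  Γbefore : ℕ → GView n
  Γbefore i = G minus Zset G (Hbefore ℓ P i)

  -- G - Z_{i-1,ℓ_{i-1}} has a cycle meeting V(H_{i-1,ℓ_{i-1}}) in exactly one vertex
  -- (i.e. P_{i,1} is of type 1)
  Type1 : ℕ → Set
  Type1 i = Σ _ λ c → Σ _ λ x → IsCycle (Γbefore i) c × MeetsOnceAt (Hbefore ℓ P i) c x

  -- c_i = v  (the vertex in which P_{i,1} meets V(H_{i-1,ℓ_{i-1}}))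
  IsC : ℕ → Fin n → Set
  IsC i v = MeetsOnceAt (Hbefore ℓ P i) (P i 1) v

  record IsCoarseEarDecomp (t : ℕ) : Set where
    field
      ℓ-pos : ∀ i → 1 ≤ i → i ≤ t → 1 ≤ ℓ i
      condA : ∀ i → 1 ≤ i → i ≤ t → ∀ a b p →
              ¬ HPath (Γbefore i) (Hbefore ℓ P i) a b p
      condB1 : ∀ i → 1 ≤ i → i ≤ t → Type1 i →
               (Σ _ λ x → IsCycle (Γbefore i) (P i 1) × MeetsOnceAt (Hbefore ℓ P i) (P i 1) x)
               × (∀ c y → IsCycle (Γbefore i) c → MeetsOnceAt (Hbefore ℓ P i) c y →
                    earLen (P i 1) ≤ earLen c)
      condB2 : ∀ i → 1 ≤ i → i ≤ t → ¬ Type1 i →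
               IsCycle (Γbefore i) (P i 1)
               × (∀ c → IsCycle (Γbefore i) c → earLen (P i 1) ≤ earLen c)
      condC : ∀ i j → 1 ≤ i → i ≤ t → 2 ≤ j → j ≤ ℓ i →
              (Σ _ λ a → Σ _ λ b →
                 HPath (G minus Zset G (Hij ℓ P i (j ∸ 1))) (Hij ℓ P i (j ∸ 1)) a b (P i j))
              × (∀ a b q → HPath (G minus Zset G (Hij ℓ P i (j ∸ 1))) (Hij ℓ P i (j ∸ 1)) a b q →
                   earLen (P i j) ≤ earLen q)

{-# OPTIONS --safe #-}
-- Fix a vertex v and add the ears one at a time, keeping track of the Profile of v:
-- either v is not yet a vertex of H, or it has degree 2 and no event has happened at
-- it, or degree 3 and exactly one path ear P i j (j ≥ 2) ends at v, or degree 4 and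
-- exactly one type-1 cycle P i 1 is attached at v.  Every ear lies in G − Z and Z
-- contains the vertices of degree ≥ 3 of H, so an ear is only attached at vertices of
-- degree 2: the ends of a path ear go from degree 2 to 3, the vertex c i of a type-1
-- cycle from 2 to 4, and the inner vertices of an ear are new, of degree 2.  A type-2
-- cycle cannot have vertices both in H and outside H, for walking from H into the
-- outside and on to the next vertex of H either gives an H-path in G − Z, excluded by
-- (A), or shows that the cycle meets H in a single vertex.  Likewise an edge of the
-- cycle joining two vertices of H but not in H would be an H-path.  So a type-2 cycle
-- either avoids H, creating vertices of degree 2, or runs along H and changes nothing.
module Submission where

open import Data.Bool using (Bool; true; false; _∧_; _∨_; T; if_then_else_)
open import Data.Bool.Properties using (T-∨)
open import Data.Empty using (⊥; ⊥-elim)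
open import Data.Fin using (Fin; _≟_)
open import Data.List
  using (List; []; _∷_; _++_; [_]; map; concatMap; upTo; allFin; length; head; last; fromMaybe; initLast; _∷ʳ′_)
open import Data.List.Properties
  using (map-cong; map-++; ++-assoc; ++-identityʳ; concatMap-++; upTo-∷ʳ; length-++; ∷-injective; ∷ʳ-injective)
import Data.List.Membership.DecPropositional as DecMembership
open import Data.List.Membership.Propositional using (_∈_; _∉_; lose; find)
open import Data.List.Membership.Propositional.Properties using (∈-allFin; ∈-++⁺ˡ; ∈-++⁺ʳ; ∈-++⁻; ∈-∃++)
open import Data.List.Relation.Binary.Permutation.Propositional using (_↭_; ↭-refl; ↭-sym; ↭⇒↭ₛ)
import Data.List.Relation.Binary.Permutation.Propositional.Properties as ↭
import Data.List.Relation.Binary.Permutation.Setoid.Properties as PermutationSetoid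
open import Data.List.Relation.Unary.All as All using (All; []; _∷_)
import Data.List.Relation.Unary.All.Properties as Allₚ
open import Data.List.Relation.Unary.Any as Any using (Any; here; there)
import Data.List.Relation.Unary.Any.Properties as Anyₚ
import Data.List.Relation.Unary.First as First
import Data.List.Relation.Unary.First.Properties as First
open import Data.List.Relation.Unary.Unique.Propositional using (Unique; []; _∷_)
import Data.List.Relation.Unary.Unique.Propositional.Properties as Uniqueₚ
open import Data.Maybe using (Maybe; just; nothing)
open import Data.Nat using (ℕ; zero; suc; _+_; _≤_; _<_; z≤n; s≤s)
open import Data.Nat.ListAction using (sum)
import Data.Nat.Properties as ℕ
open import Data.Product using (∃; ∃₂; ∃!; _×_; _,_; proj₁; proj₂)
import Data.Product as Product
open import Data.Product.Relation.Binary.Lex.Strict using (×-Lex)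
open import Data.Sum using (_⊎_; inj₁; inj₂; [_,_]′)
import Data.Sum as Sum
open import Data.Unit using (tt)
open import Function using (_∘_; id)
open import Function.Bundles using (_⇔_; mk⇔; Equivalence)
open import Function.Construct.Composition using (_⇔-∘_)
import Function.Properties.Equivalence as ⇔
open import Level using (0ℓ)
open import Relation.Binary.PropositionalEquality
  using (_≡_; _≢_; refl; sym; trans; cong; cong₂; subst; subst₂; module ≡-Reasoning)
  renaming (setoid to ≡-setoid)
open import Relation.Nullary using (¬_; Dec; yes; no; does; contradiction; Stable; ¬¬-map; negated-stable)
open import Relation.Nullary.Decidable
  using (⌊_⌋; toWitness; fromWitness; _→-dec_; toSum; T?; ¬?; decidable-stable)
open import Relation.Unary using (Pred; Decidable; Empty; _⊆_; _≐_; _∪_; ｛_｝)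
open import Relation.Unary.Properties using (≐-refl; ≐-sym; ≐-trans)

open import Defs hiding (sym)

open Equivalence using (to; from)

module FinMembership {n : ℕ} = DecMembership (_≟_ {n})
open FinMembership using (_∈?_)

T-injective : ∀ {a b} → (T a ⇔ T b) → a ≡ b
T-injective {false} {false} _   = refl
T-injective {false} {true}  a⇔b = ⊥-elim (from a⇔b tt)
T-injective {true}  {false} a⇔b = ⊥-elim (to a⇔b tt)
T-injective {true}  {true}  _   = refl

T-⌊⌋ : ∀ {P : Set} (p? : Dec P) → T ⌊ p? ⌋ ⇔ P
T-⌊⌋ p? = mk⇔ (toWitness {a? = p?}) fromWitness

count : ∀ {n} → (Fin n → Bool) → List (Fin n) → ℕ
count f xs = sum (map (λ u → if f u then 1 else 0) xs)

module _ {n : ℕ} where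

  count-cong : ∀ {f g : Fin n → Bool} → (∀ u → T (f u) ⇔ T (g u)) → ∀ xs → count f xs ≡ count g xs
  count-cong f⇔g xs = cong sum (map-cong (λ u → cong (λ b → if b then 1 else 0) (T-injective (f⇔g u))) xs)

  count-none : ∀ {f : Fin n → Bool} {xs} → All (λ u → ¬ T (f u)) xs → count f xs ≡ 0
  count-none {f} {[]}    []           = refl
  count-none {f} {x ∷ _} (¬fx ∷ rest) with f x
  ... | true  = ⊥-elim (¬fx tt)
  ... | false = count-none rest

  count-∨ : ∀ {f g : Fin n → Bool} → (∀ u → T (f u) → ¬ T (g u)) →
            ∀ xs → count (λ u → f u ∨ g u) xs ≡ count f xs + count g xs
  count-∨ {f} {g} disjoint []       = refl
  count-∨ {f} {g} disjoint (x ∷ xs) with f x | g x | disjoint x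
  ... | true  | true  | fx⇒¬gx = ⊥-elim (fx⇒¬gx tt tt)
  ... | true  | false | _      = cong suc (count-∨ disjoint xs)
  ... | false | true  | _      = trans (cong suc (count-∨ disjoint xs)) (sym (ℕ.+-suc _ _))
  ... | false | false | _      = count-∨ disjoint xs

  count-≟ : ∀ (w : Fin n) {xs} → Unique xs → w ∈ xs → count (λ u → ⌊ u ≟ w ⌋) xs ≡ 1
  count-≟ w {x ∷ xs} (x∉xs ∷ uxs) w∈ with x ≟ w | w∈
  ... | yes refl | _          =
    cong suc (count-none (All.map (λ {u} x≢u → x≢u ∘ sym ∘ to (T-⌊⌋ (u ≟ x))) x∉xs))
  ... | no x≢w   | here w≡x   = ⊥-elim (x≢w (sym w≡x))
  ... | no _     | there w∈xs = count-≟ w uxs w∈xs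

  count-≡-length : ∀ {g : Fin n → Bool} ws → Unique ws → (∀ u → T (g u) ⇔ u ∈ ws) →
                   count g (allFin n) ≡ length ws
  count-≡-length [] _ g⇔∈ = count-none {xs = allFin n} (All.tabulate (λ {u} _ → ∉[] ∘ to (g⇔∈ u)))
    where ∉[] : ∀ {u} → u ∉ []
          ∉[] ()
  count-≡-length {g} (w ∷ ws) uws@(_ ∷ uws′) g⇔∈ = begin
    count g (allFin n)                                     ≡⟨ count-cong split (allFin n) ⟩
    count (λ u → ⌊ u ≟ w ⌋ ∨ ⌊ u ∈? ws ⌋) (allFin n)       ≡⟨ count-∨ disjoint (allFin n) ⟩
    count (λ u → ⌊ u ≟ w ⌋) (allFin n) + count (λ u → ⌊ u ∈? ws ⌋) (allFin n)
      ≡⟨ cong₂ _+_ (count-≟ w (Uniqueₚ.allFin⁺ n) (∈-allFin w))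
                   (count-≡-length ws uws′ (λ u → T-⌊⌋ (u ∈? ws))) ⟩
    suc (length ws)                                        ∎
    where
    open ≡-Reasoning
    split : ∀ u → T (g u) ⇔ T (⌊ u ≟ w ⌋ ∨ ⌊ u ∈? ws ⌋)
    split u = mk⇔
      (from (T-∨ {⌊ u ≟ w ⌋}) ∘ Sum.map (from (T-⌊⌋ (u ≟ w))) (from (T-⌊⌋ (u ∈? ws))) ∘ Any.toSum ∘ to (g⇔∈ u))
      (from (g⇔∈ u) ∘ Any.fromSum ∘ Sum.map (to (T-⌊⌋ (u ≟ w))) (to (T-⌊⌋ (u ∈? ws))) ∘ to T-∨)
    disjoint : ∀ u → T ⌊ u ≟ w ⌋ → ¬ T ⌊ u ∈? ws ⌋
    disjoint u u≡w u∈ws =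
      Uniqueₚ.Unique[x∷xs]⇒x∉xs uws (subst (_∈ ws) (to (T-⌊⌋ (u ≟ w)) u≡w) (to (T-⌊⌋ (u ∈? ws)) u∈ws))

module _ {A : Set} where

  Unique-++-disjoint : ∀ xs {ys} {u : A} → Unique (xs ++ ys) → u ∈ xs → u ∈ ys → ⊥
  Unique-++-disjoint (x ∷ xs) (x∉ ∷ _) (here refl) u∈ys = All.lookup x∉ (∈-++⁺ʳ xs u∈ys) refl
  Unique-++-disjoint (x ∷ xs) (_ ∷ u)  (there u∈)  u∈ys = Unique-++-disjoint xs u u∈ u∈ys

  Unique-++⁻ˡ : ∀ xs {ys : List A} → Unique (xs ++ ys) → Unique xs
  Unique-++⁻ˡ []       _        = []
  Unique-++⁻ˡ (x ∷ xs) (x∉ ∷ u) = Allₚ.++⁻ˡ xs x∉ ∷ Unique-++⁻ˡ xs u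

  Unique-++⁻ʳ : ∀ xs {ys : List A} → Unique (xs ++ ys) → Unique ys
  Unique-++⁻ʳ []       u       = u
  Unique-++⁻ʳ (x ∷ xs) (_ ∷ u) = Unique-++⁻ʳ xs u

  Unique-fromMaybe : ∀ (m : Maybe A) → Unique (fromMaybe m)
  Unique-fromMaybe nothing  = []
  Unique-fromMaybe (just _) = [] ∷ []

  ∈-fromMaybe-last⁻ : ∀ xs {u : A} → u ∈ fromMaybe (last xs) → ∃ λ init → xs ≡ init ++ [ u ]
  ∈-fromMaybe-last⁻ (x ∷ [])     (here refl) = [] , refl
  ∈-fromMaybe-last⁻ (x ∷ y ∷ ys) u∈          =
    Product.map (x ∷_) (cong (x ∷_)) (∈-fromMaybe-last⁻ (y ∷ ys) u∈)

  fromMaybe-last-⊆ : ∀ xs {u : A} → u ∈ fromMaybe (last xs) → u ∈ xs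
  fromMaybe-last-⊆ xs u∈ with ∈-fromMaybe-last⁻ xs u∈
  ... | init , refl = ∈-++⁺ʳ init (here refl)

  fromMaybe-head-⊆ : ∀ xs {u : A} → u ∈ fromMaybe (head xs) → u ∈ xs
  fromMaybe-head-⊆ (_ ∷ _) (here refl) = here refl

  length-fromMaybe-last : ∀ (x : A) xs → length (fromMaybe (last (x ∷ xs))) ≡ 1
  length-fromMaybe-last x []       = refl
  length-fromMaybe-last x (y ∷ ys) = length-fromMaybe-last y ys

  length-fromMaybe-head : ∀ xs {x : A} → length (fromMaybe (head (xs ++ [ x ]))) ≡ 1
  length-fromMaybe-head []      = refl
  length-fromMaybe-head (_ ∷ _) = refl

module _ {n : ℕ} where

  Consec-∈ˡ : ∀ {e} {u w : Fin n} → Consec e u w → u ∈ e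
  Consec-∈ˡ here      = here refl
  Consec-∈ˡ (there c) = there (Consec-∈ˡ c)

  Consec-∈ʳ : ∀ {e} {u w : Fin n} → Consec e u w → w ∈ e
  Consec-∈ʳ here      = there (here refl)
  Consec-∈ʳ (there c) = there (Consec-∈ʳ c)

  Consec-∷-target : ∀ {x : Fin n} {xs u w} → Consec (x ∷ xs) u w → w ∈ xs
  Consec-∷-target here      = here refl
  Consec-∷-target (there c) = Consec-∈ʳ c

  Consec-∷ʳ-source : ∀ xs {y u w : Fin n} → Consec (xs ++ [ y ]) u w → u ∈ xs
  Consec-∷ʳ-source []          (there ())
  Consec-∷ʳ-source (x ∷ [])    here      = here refl
  Consec-∷ʳ-source (x ∷ _ ∷ _) here      = here refl
  Consec-∷ʳ-source (x ∷ xs)    (there c) = there (Consec-∷ʳ-source xs c)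

  Consec-∷ʳ-last : ∀ xs {v u : Fin n} → v ∉ xs → Consec (xs ++ [ v ]) u v → u ∈ fromMaybe (last xs)
  Consec-∷ʳ-last []           v∉ (there ())
  Consec-∷ʳ-last (x ∷ [])     v∉ here               = here refl
  Consec-∷ʳ-last (x ∷ [])     v∉ (there (there ()))
  Consec-∷ʳ-last (x ∷ y ∷ ys) v∉ here               = ⊥-elim (v∉ (there (here refl)))
  Consec-∷ʳ-last (x ∷ y ∷ ys) v∉ (there c)          = Consec-∷ʳ-last (y ∷ ys) (v∉ ∘ there) c

  Consec-++⁺ˡ : ∀ {xs} ys {u w : Fin n} → Consec xs u w → Consec (xs ++ ys) u w
  Consec-++⁺ˡ ys here      = here
  Consec-++⁺ˡ ys (there c) = there (Consec-++⁺ˡ ys c)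

  Consec-++⁺ʳ : ∀ xs {ys} {u w : Fin n} → Consec ys u w → Consec (xs ++ ys) u w
  Consec-++⁺ʳ []       c = c
  Consec-++⁺ʳ (x ∷ xs) c = there (Consec-++⁺ʳ xs c)

  Consec-++ : ∀ xs {y ys} {u w : Fin n} →
              Consec (xs ++ y ∷ ys) u w ⇔ (Consec (xs ++ [ y ]) u w ⊎ Consec (y ∷ ys) u w)
  Consec-++ xs {y} {ys} {u} {w} = mk⇔ (split xs) [ join , Consec-++⁺ʳ xs ]′
    where
    split : ∀ xs → Consec (xs ++ y ∷ ys) u w → Consec (xs ++ [ y ]) u w ⊎ Consec (y ∷ ys) u w
    split []          c         = inj₂ c
    split (x ∷ [])    here      = inj₁ here
    split (x ∷ _ ∷ _) here      = inj₁ here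
    split (x ∷ xs)    (there c) = Sum.map₁ there (split xs c)
    join : Consec (xs ++ [ y ]) u w → Consec (xs ++ y ∷ ys) u w
    join c = subst (λ l → Consec l u w) (++-assoc xs [ y ] ys) (Consec-++⁺ˡ ys c)

  Consec-last : ∀ xs {v u : Fin n} ys → u ∈ fromMaybe (last xs) → Consec (xs ++ v ∷ ys) u v
  Consec-last xs {v} ys u∈ with ∈-fromMaybe-last⁻ xs u∈
  ... | init , refl = subst (λ l → Consec l _ v) (sym (++-assoc init [ _ ] (v ∷ ys))) (Consec-++⁺ʳ init here)

  Consec-inner : ∀ {a b : Fin n} {m mid u w} → Consec (a ∷ (m ∷ mid) ++ [ b ]) u w →
                 u ∈ m ∷ mid ⊎ w ∈ m ∷ mid
  Consec-inner here      = inj₂ (here refl)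
  Consec-inner (there c) = inj₁ (Consec-∷ʳ-source (_ ∷ _) c)

module _ {n : ℕ} where

  Adj : Ear n → Fin n → Fin n → Set
  Adj e v u = Consec e v u ⊎ Consec e u v

  adjB : Ear n → Fin n → Fin n → Bool
  adjB e v u = consecB e v u ∨ consecB e u v

  Adj-sym : ∀ {e} {v u : Fin n} → Adj e v u → Adj e u v
  Adj-sym = Sum.swap

  Adj-∈ : ∀ {e} {v u : Fin n} → Adj e v u → v ∈ e
  Adj-∈ = [ Consec-∈ˡ , Consec-∈ʳ ]′

  consecB-sound : ∀ e {u w : Fin n} → T (consecB e u w) → Consec e u w
  consecB-sound (x ∷ y ∷ xs) {u} {w} t = [ atHead , there ∘ consecB-sound (y ∷ xs) ]′ (to T-∨ t)
    where
    atHead : T (does (x ≟ u) ∧ does (y ≟ w)) → Consec (x ∷ y ∷ xs) u w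
    atHead h with x ≟ u | y ≟ w
    ... | yes refl | yes refl = here
    ... | yes _    | no _     = ⊥-elim h
    ... | no _     | _        = ⊥-elim h

  consecB-complete : ∀ {e} {u w : Fin n} → Consec e u w → T (consecB e u w)
  consecB-complete {x ∷ y ∷ _} here with x ≟ x | y ≟ y
  ... | yes _  | yes _  = tt
  ... | yes _  | no y≢y = ⊥-elim (y≢y refl)
  ... | no x≢x | _      = ⊥-elim (x≢x refl)
  consecB-complete {x ∷ y ∷ _} {u} {w} (there c) =
    from (T-∨ {does (x ≟ u) ∧ does (y ≟ w)}) (inj₂ (consecB-complete c))

  T-adjB : ∀ e {v u : Fin n} → T (adjB e v u) ⇔ Adj e v u
  T-adjB e = mk⇔ (Sum.map (consecB-sound e) (consecB-sound e) ∘ to T-∨)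
                 (from T-∨ ∘ Sum.map consecB-complete consecB-complete)

  EdgeH⇔Any : ∀ (H : List (Ear n)) {v u} → EdgeH H v u ⇔ Any (λ e → Adj e v u) H
  EdgeH⇔Any H = mk⇔ (Any.map (to (T-adjB _)) ∘ Anyₚ.any⁻ _ H) (Anyₚ.any⁺ _ ∘ Any.map (from (T-adjB _)))

  EdgeH-sym : ∀ (H : List (Ear n)) {v u} → EdgeH H v u → EdgeH H u v
  EdgeH-sym H = from (EdgeH⇔Any H) ∘ Any.map Adj-sym ∘ to (EdgeH⇔Any H)

  EdgeH⇒VtxH : ∀ (H : List (Ear n)) {v u} → EdgeH H v u → VtxH H v
  EdgeH⇒VtxH H = Any.map Adj-∈ ∘ to (EdgeH⇔Any H)

  VtxH-++ : ∀ (H : List (Ear n)) e {v} → VtxH (H ++ [ e ]) v ⇔ (VtxH H v ⊎ v ∈ e)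
  VtxH-++ H e = mk⇔ (Sum.map₂ (λ { (here v∈e) → v∈e ; (there ()) }) ∘ Anyₚ.++⁻ H)
                    [ Anyₚ.++⁺ˡ , Anyₚ.++⁺ʳ H ∘ here ]′

  EdgeH-++ : ∀ (H : List (Ear n)) e {v u} → EdgeH (H ++ [ e ]) v u ⇔ (EdgeH H v u ⊎ Adj e v u)
  EdgeH-++ H e = mk⇔
    (Sum.map (from (EdgeH⇔Any H)) (λ { (here a) → a ; (there ()) }) ∘ Anyₚ.++⁻ H
       ∘ to (EdgeH⇔Any (H ++ [ e ])))
    (from (EdgeH⇔Any (H ++ [ e ])) ∘ [ Anyₚ.++⁺ˡ ∘ to (EdgeH⇔Any H) , Anyₚ.++⁺ʳ H ∘ here ]′)

  record EarDegree (e : Ear n) (v : Fin n) (k : ℕ) : Set where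
    field
      nbrs    : List (Fin n)
      unique  : Unique nbrs
      adj⇔∈   : ∀ u → Adj e v u ⇔ u ∈ nbrs
      length≡ : length nbrs ≡ k

  deg-∉ : ∀ (H : List (Ear n)) {v} → ¬ VtxH H v → deg H v ≡ 0
  deg-∉ H {v} v∉H = count-≡-length {g = edgeB H v} [] [] (λ u → mk⇔ (⊥-elim ∘ v∉H ∘ EdgeH⇒VtxH H) λ ())

  deg-++-covered : ∀ (H : List (Ear n)) e {v} → (∀ {u} → Adj e v u → EdgeH H v u) →
                   deg (H ++ [ e ]) v ≡ deg H v
  deg-++-covered H e covered =
    count-cong (λ u → mk⇔ ([ id , covered ]′ ∘ to (EdgeH-++ H e)) (from (EdgeH-++ H e) ∘ inj₁)) (allFin n)

  deg-++-fresh : ∀ (H : List (Ear n)) e {v k} → EarDegree e v k → (∀ {u} → Adj e v u → ¬ EdgeH H v u) →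
                 deg (H ++ [ e ]) v ≡ deg H v + k
  deg-++-fresh H e {v} {k} d fresh = begin
    deg (H ++ [ e ]) v
      ≡⟨ count-cong split (allFin n) ⟩
    count (λ u → edgeB H v u ∨ adjB e v u) (allFin n)
      ≡⟨ count-∨ (λ u old new → fresh (to (T-adjB e) new) old) (allFin n) ⟩
    deg H v + count (adjB e v) (allFin n)
      ≡⟨ cong (deg H v +_) (count-≡-length nbrs unique (λ u → adj⇔∈ u ⇔-∘ T-adjB e)) ⟩
    deg H v + length nbrs
      ≡⟨ cong (deg H v +_) length≡ ⟩
    deg H v + k
      ∎
    where
    open ≡-Reasoning
    open EarDegree d
    split : ∀ u → EdgeH (H ++ [ e ]) v u ⇔ T (edgeB H v u ∨ adjB e v u)
    split u = mk⇔ (from T-∨ ∘ Sum.map₂ (from (T-adjB e)) ∘ to (EdgeH-++ H e))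
                  (from (EdgeH-++ H e) ∘ Sum.map₂ (to (T-adjB e)) ∘ to T-∨)

-- Degrees along paths and cycles

module _ {n : ℕ} where

  private module Permₛ = PermutationSetoid (≡-setoid (Fin n))

  Adj-once : ∀ xs {v : Fin n} ys → v ∉ xs → v ∉ ys →
             ∀ {u} → Adj (xs ++ v ∷ ys) v u ⇔ u ∈ fromMaybe (last xs) ++ fromMaybe (head ys)
  Adj-once xs {v} ys v∉xs v∉ys {u} =
    mk⇔ [ ∈-++⁺ʳ (fromMaybe (last xs)) ∘ successor , ∈-++⁺ˡ ∘ predecessor ]′
        ([ inj₂ ∘ Consec-last xs ys , inj₁ ∘ head-successor ys ]′ ∘ ∈-++⁻ (fromMaybe (last xs)))
    where
    successor : Consec (xs ++ v ∷ ys) v u → u ∈ fromMaybe (head ys)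
    successor c with to (Consec-++ xs) c
    ... | inj₁ c′         = ⊥-elim (v∉xs (Consec-∷ʳ-source xs c′))
    ... | inj₂ here       = here refl
    ... | inj₂ (there c′) = ⊥-elim (v∉ys (Consec-∈ˡ c′))
    predecessor : Consec (xs ++ v ∷ ys) u v → u ∈ fromMaybe (last xs)
    predecessor c with to (Consec-++ xs) c
    ... | inj₁ c′ = Consec-∷ʳ-last xs v∉xs c′
    ... | inj₂ c′ = ⊥-elim (v∉ys (Consec-∷-target c′))
    head-successor : ∀ ys → u ∈ fromMaybe (head ys) → Consec (xs ++ v ∷ ys) v u
    head-successor (_ ∷ _) (here refl) = Consec-++⁺ʳ xs here

  EarDegree-once : ∀ xs {v : Fin n} ys → Unique (xs ++ v ∷ ys) →
                   EarDegree (xs ++ v ∷ ys) v (length (fromMaybe (last xs)) + length (fromMaybe (head ys)))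
  EarDegree-once xs {v} ys u = record
    { nbrs    = fromMaybe (last xs) ++ fromMaybe (head ys)
    ; unique  = Uniqueₚ.++⁺ (Unique-fromMaybe (last xs)) (Unique-fromMaybe (head ys))
                  (λ (∈last , ∈head) →
                     Unique-++-disjoint xs u (fromMaybe-last-⊆ xs ∈last) (there (fromMaybe-head-⊆ ys ∈head)))
    ; adj⇔∈   = λ _ → Adj-once xs ys (λ v∈xs → Unique-++-disjoint xs u v∈xs (here refl))
                                     (Uniqueₚ.Unique[x∷xs]⇒x∉xs (Unique-++⁻ʳ xs u))
    ; length≡ = length-++ (fromMaybe (last xs))
    }

  module _ {a b : Fin n} {mid} (u : Unique (a ∷ mid ++ [ b ])) where

    EarDegree-path-start : EarDegree (a ∷ mid ++ [ b ]) a 1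
    EarDegree-path-start = subst (EarDegree _ a) (length-fromMaybe-head mid) (EarDegree-once [] (mid ++ [ b ]) u)

    EarDegree-path-end : EarDegree (a ∷ mid ++ [ b ]) b 1
    EarDegree-path-end = subst (EarDegree _ b) (trans (ℕ.+-identityʳ _) (length-fromMaybe-last a mid))
                           (EarDegree-once (a ∷ mid) [] u)

    EarDegree-path-inner : ∀ {v} → v ∈ mid → EarDegree (a ∷ mid ++ [ b ]) v 2
    EarDegree-path-inner {v} v∈mid with ∈-∃++ v∈mid
    ... | A , B , refl =
      subst₂ (λ e → EarDegree e v) (sym split) (cong₂ _+_ (length-fromMaybe-last a A) (length-fromMaybe-head B))
        (EarDegree-once (a ∷ A) (B ++ [ b ]) (subst Unique split u))
      where split : a ∷ (A ++ v ∷ B) ++ [ b ] ≡ (a ∷ A) ++ v ∷ (B ++ [ b ])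
            split = cong (a ∷_) (++-assoc A (v ∷ B) [ b ])

  EarDegree-resp : ∀ {e e′} {v : Fin n} {k} → (∀ {u w} → Consec e u w ⇔ Consec e′ u w) →
                   EarDegree e v k → EarDegree e′ v k
  EarDegree-resp e⇔e′ d = record
    { nbrs    = nbrs
    ; unique  = unique
    ; adj⇔∈   = λ u → adj⇔∈ u ⇔-∘ mk⇔ (Sum.map (from e⇔e′) (from e⇔e′)) (Sum.map (to e⇔e′) (to e⇔e′))
    ; length≡ = length≡
    }
    where open EarDegree d

  cycle : Fin n → List (Fin n) → Ear n
  cycle x M = x ∷ M ++ [ x ]

  ∈-cycle : ∀ {x : Fin n} M {u} → u ∈ cycle x M ⇔ u ∈ x ∷ M
  ∈-cycle M = mk⇔ to′ from′
    where
    to′ : ∀ {x u} → u ∈ cycle x M → u ∈ x ∷ M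
    to′ (here u≡x) = here u≡x
    to′ (there u∈) with ∈-++⁻ M u∈
    ... | inj₁ u∈M        = there u∈M
    ... | inj₂ (here u≡x) = here u≡x
    from′ : ∀ {x u} → u ∈ x ∷ M → u ∈ cycle x M
    from′ (here u≡x)  = here u≡x
    from′ (there u∈M) = there (∈-++⁺ˡ u∈M)

  EarDegree-cycle-start : ∀ {x : Fin n} {M} → Unique (x ∷ M) → 2 ≤ length M → EarDegree (cycle x M) x 2
  EarDegree-cycle-start {x} {m ∷ r ∷ R} u@(_ ∷ m∉R ∷ _) (s≤s (s≤s z≤n)) = record
    { nbrs    = m ∷ fromMaybe (last (r ∷ R))
    ; unique  = All.tabulate (All.lookup m∉R ∘ fromMaybe-last-⊆ (r ∷ R)) ∷ Unique-fromMaybe (last (r ∷ R))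
    ; adj⇔∈   = λ _ → mk⇔ [ successor , there ∘ predecessor ]′ complete
    ; length≡ = cong suc (length-fromMaybe-last r R)
    }
    where
    M : List (Fin n)
    M = m ∷ r ∷ R
    x∉M : x ∉ M
    x∉M = Uniqueₚ.Unique[x∷xs]⇒x∉xs u
    successor : ∀ {w} → Consec (cycle x M) x w → w ∈ m ∷ fromMaybe (last (r ∷ R))
    successor here      = here refl
    successor (there c) = ⊥-elim (x∉M (Consec-∷ʳ-source M c))
    predecessor : ∀ {w} → Consec (cycle x M) w x → w ∈ fromMaybe (last (r ∷ R))
    predecessor here      = ⊥-elim (x∉M (here refl))
    predecessor (there c) = Consec-∷ʳ-last M x∉M c
    complete : ∀ {w} → w ∈ m ∷ fromMaybe (last (r ∷ R)) → Adj (cycle x M) x w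
    complete (here refl) = inj₁ here
    complete (there w∈)  = inj₂ (there (Consec-last M [] w∈))

  record Rotation (x : Fin n) (M : List (Fin n)) (v : Fin n) : Set where
    constructor rotation
    field
      rest    : List (Fin n)
      perm    : v ∷ rest ↭ x ∷ M
      consec⇔ : ∀ {u w} → Consec (cycle v rest) u w ⇔ Consec (cycle x M) u w

  rotate : ∀ {x : Fin n} {M v} → v ∈ x ∷ M → Rotation x M v
  rotate {M = M} (here refl) = rotation M ↭-refl ⇔.refl
  rotate {x} (there v∈M) with ∈-∃++ v∈M
  ... | A , R , refl = rotation (R ++ x ∷ A) (↭.++-comm (_ ∷ R) (x ∷ A))
    (⇔.trans (Consec-≡ (cong (_ ∷_) (++-assoc R (x ∷ A) [ _ ])))
    (⇔.trans (Consec-++ (_ ∷ R))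
    (⇔.trans (mk⇔ Sum.swap Sum.swap)
    (⇔.trans (⇔.sym (Consec-++ (x ∷ A)))
             (Consec-≡ (cong (x ∷_) (sym (++-assoc A (_ ∷ R) [ x ]))))))))
    where Consec-≡ : ∀ {l l′} {u w : Fin n} → l ≡ l′ → Consec l u w ⇔ Consec l′ u w
          Consec-≡ refl = ⇔.refl

  Rotation-∈ : ∀ {x : Fin n} {M v} (r : Rotation x M v) {u} → u ∈ cycle v (Rotation.rest r) ⇔ u ∈ cycle x M
  Rotation-∈ r =
    ⇔.trans (∈-cycle _) (⇔.trans (mk⇔ (↭.∈-resp-↭ perm) (↭.∈-resp-↭ (↭-sym perm))) (⇔.sym (∈-cycle _)))
    where open Rotation r

  Rotation-Unique : ∀ {x : Fin n} {M v} (r : Rotation x M v) → Unique (x ∷ M) → Unique (v ∷ Rotation.rest r)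
  Rotation-Unique r = Permₛ.Unique-resp-↭ (↭⇒↭ₛ (↭-sym (Rotation.perm r)))

  EarDegree-cycle : ∀ {x : Fin n} {M v} → Unique (x ∷ M) → 2 ≤ length M → v ∈ cycle x M →
                    EarDegree (cycle x M) v 2
  EarDegree-cycle {x} {M} {v} u long v∈ =
    EarDegree-resp consec⇔
      (EarDegree-cycle-start (Rotation-Unique r u) (subst (2 ≤_) (sym (ℕ.suc-injective (↭.↭-length perm))) long))
    where r : Rotation x M v
          r = rotate (to (∈-cycle M) v∈)
          open Rotation r

  transition : ∀ {Q : Pred (Fin n) 0ℓ} → Decidable Q → ∀ {a z} l → Q a → z ∈ l → ¬ Q z →
               ∃₂ λ u w → Consec (a ∷ l) u w × Q u × ¬ Q w
  transition Q? (m ∷ l) Qa z∈ ¬Qz with Q? m | z∈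
  ... | no ¬Qm | _         = _ , _ , here , Qa , ¬Qm
  ... | yes Qm | here refl = ⊥-elim (¬Qz Qm)
  ... | yes Qm | there z∈l with transition Q? l Qm z∈l ¬Qz
  ...   | u , w , c , Qu , ¬Qw = u , w , there c , Qu , ¬Qw

  cycle-transition : ∀ {Q : Pred (Fin n) 0ℓ} → Decidable Q → ∀ {x M y z} →
                     y ∈ cycle x M → Q y → z ∈ cycle x M → ¬ Q z →
                     ∃₂ λ u w → Consec (cycle x M) u w × Q u × ¬ Q w
  cycle-transition {Q} Q? {x} {M} {y} {z} y∈ Qy z∈ ¬Qz = fromRotation (rotate (to (∈-cycle M) y∈))
    where
    fromRotation : Rotation x M y → ∃₂ λ u w → Consec (cycle x M) u w × Q u × ¬ Q w
    fromRotation r@(rotation rest _ consec⇔) with from (Rotation-∈ r) z∈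
    ... | here refl = ⊥-elim (¬Qz Qy)
    ... | there z∈′ with transition Q? (rest ++ [ y ]) Qy z∈′ ¬Qz
    ...   | u , w , c , Qu , ¬Qw = u , w , to consec⇔ c , Qu , ¬Qw

  cycle-successor : ∀ {u w : Fin n} {R} → u ∉ R → u ≢ w → Consec (cycle u R) u w →
                    ∃ λ R′ → R ≡ w ∷ R′
  cycle-successor {R = []}     _   u≢w here      = ⊥-elim (u≢w refl)
  cycle-successor {R = _ ∷ R′} _   _   here      = R′ , refl
  cycle-successor {R = R}      u∉R _   (there c) = ⊥-elim (u∉R (Consec-∷ʳ-source R c))

-- The degree profile of a vertex

module _ {X : Set} where

  Empty-⊆ : ∀ {P Q : Pred X 0ℓ} → Q ⊆ P → Empty P → Empty Q
  Empty-⊆ Q⊆P ∅P x = ∅P x ∘ Q⊆P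

  ∃!-≐ : ∀ {P Q : Pred X 0ℓ} → P ≐ Q → ∃! _≡_ P → ∃! _≡_ Q
  ∃!-≐ (P⊆Q , Q⊆P) (x , Px , unique) = x , P⊆Q Px , unique ∘ Q⊆P

  ≐-∪-Empty : ∀ {P Q : Pred X 0ℓ} → Empty Q → P ≐ (P ∪ Q)
  ≐-∪-Empty ∅Q = inj₁ , λ {x} → [ id , ⊥-elim ∘ ∅Q x ]′

  ∃!-∪-｛｝ : ∀ {P : Pred X 0ℓ} {x₀} → Empty P → ∃! _≡_ (P ∪ ｛ x₀ ｝)
  ∃!-∪-｛｝ ∅P = _ , inj₂ refl , λ {y} → [ ⊥-elim ∘ ∅P y , id ]′

module _ {n : ℕ} {A B : Set} where

  -- E and C collect the events at v so far: the path ears ending at v and the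
  -- type-1 cycles attached at v.
  data Profile (H : List (Ear n)) (v : Fin n) (E : Pred A 0ℓ) (C : Pred B 0ℓ) : Set where
    absent  : ¬ VtxH H v → Empty E → Empty C → Profile H v E C
    degree2 : VtxH H v → deg H v ≡ 2 → Empty E → Empty C → Profile H v E C
    degree3 : VtxH H v → deg H v ≡ 3 → ∃! _≡_ E → Empty C → Profile H v E C
    degree4 : VtxH H v → deg H v ≡ 4 → Empty E → ∃! _≡_ C → Profile H v E C

  private
    variable
      H    : List (Ear n)
      e    : Ear n
      v    : Fin n
      E E′ : Pred A 0ℓ
      C C′ : Pred B 0ℓ

  Profile-≐ : E ≐ E′ → C ≐ C′ → Profile H v E C → Profile H v E′ C′
  Profile-≐ E≐ C≐ (absent v∉ ∅E ∅C)    = absent v∉ (Empty-⊆ (proj₂ E≐) ∅E) (Empty-⊆ (proj₂ C≐) ∅C)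
  Profile-≐ E≐ C≐ (degree2 v∈ d ∅E ∅C) = degree2 v∈ d (Empty-⊆ (proj₂ E≐) ∅E) (Empty-⊆ (proj₂ C≐) ∅C)
  Profile-≐ E≐ C≐ (degree3 v∈ d !E ∅C) = degree3 v∈ d (∃!-≐ E≐ !E) (Empty-⊆ (proj₂ C≐) ∅C)
  Profile-≐ E≐ C≐ (degree4 v∈ d ∅E !C) = degree4 v∈ d (Empty-⊆ (proj₂ E≐) ∅E) (∃!-≐ C≐ !C)

  Profile-degree : VtxH H v → Profile H v E C → (deg H v ≡ 3 ⇔ ∃! _≡_ E) × (deg H v ≡ 4 ⇔ ∃! _≡_ C)
  Profile-degree v∈ (absent v∉ _ _)     = ⊥-elim (v∉ v∈)
  Profile-degree _  (degree2 _ d ∅E ∅C) =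
    mk⇔ (λ d≡3 → contradiction (trans (sym d) d≡3) λ ()) (λ (x , Ex , _) → ⊥-elim (∅E x Ex)) ,
    mk⇔ (λ d≡4 → contradiction (trans (sym d) d≡4) λ ()) (λ (y , Cy , _) → ⊥-elim (∅C y Cy))
  Profile-degree _  (degree3 _ d !E ∅C) =
    mk⇔ (λ _ → !E) (λ _ → d) ,
    mk⇔ (λ d≡4 → contradiction (trans (sym d) d≡4) λ ()) (λ (y , Cy , _) → ⊥-elim (∅C y Cy))
  Profile-degree _  (degree4 _ d ∅E !C) =
    mk⇔ (λ d≡3 → contradiction (trans (sym d) d≡3) λ ()) (λ (x , Ex , _) → ⊥-elim (∅E x Ex)) ,
    mk⇔ (λ _ → !C) (λ _ → d)

  Profile-absent : Profile H v E C → ¬ VtxH H v → Empty E × Empty C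
  Profile-absent (absent _ ∅E ∅C)   _  = ∅E , ∅C
  Profile-absent (degree2 v∈ _ _ _) v∉ = ⊥-elim (v∉ v∈)
  Profile-absent (degree3 v∈ _ _ _) v∉ = ⊥-elim (v∉ v∈)
  Profile-absent (degree4 v∈ _ _ _) v∉ = ⊥-elim (v∉ v∈)

  Profile-degree≤2 : Profile H v E C → VtxH H v → deg H v ≤ 2 → deg H v ≡ 2 × Empty E × Empty C
  Profile-degree≤2 (absent v∉ _ _)     v∈ _   = ⊥-elim (v∉ v∈)
  Profile-degree≤2 (degree2 _ d ∅E ∅C) _  _   = d , ∅E , ∅C
  Profile-degree≤2 (degree3 _ d _ _)   _  d≤2 with subst (_≤ 2) d d≤2
  ... | s≤s (s≤s ())
  Profile-degree≤2 (degree4 _ d _ _)   _  d≤2 with subst (_≤ 2) d d≤2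
  ... | s≤s (s≤s ())

  Profile-++-covered : (v ∈ e → VtxH H v) → (∀ {u} → Adj e v u → EdgeH H v u) →
                       Profile H v E C → Profile (H ++ [ e ]) v E C
  Profile-++-covered {v} {e} {H} v∈e⇒v∈H covered pr with deg-++-covered H e {v} covered | pr
  ... | d≡ | absent v∉ ∅E ∅C    = absent ([ v∉ , v∉ ∘ v∈e⇒v∈H ]′ ∘ to (VtxH-++ H e)) ∅E ∅C
  ... | d≡ | degree2 v∈ d ∅E ∅C = degree2 (from (VtxH-++ H e) (inj₁ v∈)) (trans d≡ d) ∅E ∅C
  ... | d≡ | degree3 v∈ d !E ∅C = degree3 (from (VtxH-++ H e) (inj₁ v∈)) (trans d≡ d) !E ∅C
  ... | d≡ | degree4 v∈ d ∅E !C = degree4 (from (VtxH-++ H e) (inj₁ v∈)) (trans d≡ d) ∅E !C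

  Profile-++-∉ : v ∉ e → Profile H v E C → Profile (H ++ [ e ]) v E C
  Profile-++-∉ v∉e = Profile-++-covered (⊥-elim ∘ v∉e) (⊥-elim ∘ v∉e ∘ Adj-∈)

  Profile-++-new : v ∈ e → ¬ VtxH H v → EarDegree e v 2 → Profile H v E C → Profile (H ++ [ e ]) v E C
  Profile-++-new {v} {e} {H} v∈e v∉H d pr with Profile-absent pr v∉H
  ... | ∅E , ∅C = degree2 (from (VtxH-++ H e) (inj₂ v∈e))
                    (trans (deg-++-fresh H e d (λ _ → v∉H ∘ EdgeH⇒VtxH H)) (cong (_+ 2) (deg-∉ H v∉H)))
                    ∅E ∅C

  Profile-++-attach : ∀ {k} → VtxH H v → deg H v ≤ 2 → EarDegree e v k → (∀ {u} → Adj e v u → ¬ EdgeH H v u) →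
                      Profile H v E C → VtxH (H ++ [ e ]) v × deg (H ++ [ e ]) v ≡ 2 + k × Empty E × Empty C
  Profile-++-attach {H} {v} {e} v∈H d≤2 d fresh pr with Profile-degree≤2 pr v∈H d≤2
  ... | d≡2 , ∅E , ∅C =
    from (VtxH-++ H e) (inj₁ v∈H) , trans (deg-++-fresh H e d fresh) (cong (_+ _) d≡2) , ∅E , ∅C

  Profile-++-end : ∀ x₀ → VtxH H v → deg H v ≤ 2 → EarDegree e v 1 → (∀ {u} → Adj e v u → ¬ EdgeH H v u) →
                   Profile H v E C → Profile (H ++ [ e ]) v (E ∪ ｛ x₀ ｝) C
  Profile-++-end x₀ v∈H d≤2 d fresh pr with Profile-++-attach v∈H d≤2 d fresh pr
  ... | v∈ , d≡3 , ∅E , ∅C = degree3 v∈ d≡3 (∃!-∪-｛｝ ∅E) ∅C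

  Profile-++-centre : ∀ y₀ → VtxH H v → deg H v ≤ 2 → EarDegree e v 2 → (∀ {u} → Adj e v u → ¬ EdgeH H v u) →
                      Profile H v E C → Profile (H ++ [ e ]) v E (C ∪ ｛ y₀ ｝)
  Profile-++-centre y₀ v∈H d≤2 d fresh pr with Profile-++-attach v∈H d≤2 d fresh pr
  ... | v∈ , d≡4 , ∅E , ∅C = degree4 v∈ d≡4 ∅E (∃!-∪-｛｝ ∅C)

  Profile-++-inside : All (VtxH H) e → (∀ {u w} → Consec e u w → EdgeH H u w) →
                      Profile H v E C → Profile (H ++ [ e ]) v E C
  Profile-++-inside {H = H} inside covered = Profile-++-covered (All.lookup inside) [ covered , EdgeH-sym H ∘ covered ]′

IsEnd-path : ∀ {n} {a b : Fin n} {mid v} → IsEnd (a ∷ mid ++ [ b ]) v ⇔ (v ≡ a ⊎ v ≡ b)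
IsEnd-path {a = a} {b} {mid} =
  mk⇔ ends (λ { (inj₁ refl) → inj₁ (b , mid , refl) ; (inj₂ refl) → inj₂ (a , mid , refl) })
  where
  ends : ∀ {v} → IsEnd (a ∷ mid ++ [ b ]) v → v ≡ a ⊎ v ≡ b
  ends (inj₁ (_ , _ , e))     = inj₁ (sym (proj₁ (∷-injective e)))
  ends (inj₂ (a′ , mid′ , e)) = inj₂ (sym (proj₂ (∷ʳ-injective (a ∷ mid) (a′ ∷ mid′) e)))

module _ {n : ℕ} {A B : Set} {H : List (Ear n)} {a b : Fin n} {mid : List (Fin n)}
         (unique : Unique (a ∷ mid ++ [ b ])) (a∈H : VtxH H a) (b∈H : VtxH H b)
         (deg-a : deg H a ≤ 2) (deg-b : deg H b ≤ 2) (mid∉H : All (λ u → ¬ VtxH H u) mid)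
         (edges∉H : ∀ {u w} → Consec (a ∷ mid ++ [ b ]) u w → ¬ EdgeH H u w) where

  private
    p : Ear n
    p = a ∷ mid ++ [ b ]

    Profile-++-pathEnd : ∀ {v} {E : Pred A 0ℓ} {C : Pred B 0ℓ} x₀ → VtxH H v → deg H v ≤ 2 →
                         EarDegree p v 1 → IsEnd p v → Profile H v E C →
                         Profile (H ++ [ p ]) v (E ∪ (λ x → x₀ ≡ x × IsEnd p v)) C
    Profile-++-pathEnd x₀ v∈H d≤2 d end pr =
      Profile-≐ (Sum.map₂ (_, end) , Sum.map₂ proj₁) ≐-refl
        (Profile-++-end x₀ v∈H d≤2 d [ edges∉H , (λ c → edges∉H c ∘ EdgeH-sym H) ]′ pr)

  Profile-++-path : ∀ {v} {E : Pred A 0ℓ} {C : Pred B 0ℓ} x₀ → Profile H v E C →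
                    Profile (H ++ [ p ]) v (E ∪ (λ x → x₀ ≡ x × IsEnd p v)) C
  Profile-++-path {v} x₀ pr with v ∈? p
  ... | no v∉p =
    Profile-≐ (≐-∪-Empty (λ _ → v∉p ∘ end∈ ∘ to (IsEnd-path {a = a} {b} {mid}) ∘ proj₂)) ≐-refl
      (Profile-++-∉ v∉p pr)
    where end∈ : v ≡ a ⊎ v ≡ b → v ∈ p
          end∈ (inj₁ refl) = here refl
          end∈ (inj₂ refl) = there (∈-++⁺ʳ mid (here refl))
  ... | yes (here refl) =
    Profile-++-pathEnd x₀ a∈H deg-a (EarDegree-path-start unique) (from IsEnd-path (inj₁ refl)) pr
  ... | yes (there v∈) with ∈-++⁻ mid v∈
  ...   | inj₂ (here refl) =
    Profile-++-pathEnd x₀ b∈H deg-b (EarDegree-path-end unique) (from IsEnd-path (inj₂ refl)) pr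
  ...   | inj₁ v∈mid =
    Profile-≐ (≐-∪-Empty (λ _ → v∉H ∘ [ (λ { refl → a∈H }) , (λ { refl → b∈H }) ]′
                                    ∘ to (IsEnd-path {a = a} {b} {mid}) ∘ proj₂))
              ≐-refl
      (Profile-++-new (there (∈-++⁺ˡ v∈mid)) v∉H (EarDegree-path-inner unique v∈mid) pr)
    where v∉H : ¬ VtxH H v
          v∉H = All.lookup mid∉H v∈mid

module _ {n : ℕ} {A B : Set} {H : List (Ear n)} {x : Fin n} {M : List (Fin n)}
         (unique : Unique (x ∷ M)) (long : 2 ≤ length M) where

  Profile-++-pendantCycle : ∀ {v} {E : Pred A 0ℓ} {C : Pred B 0ℓ} {c₀} y₀ →
                            (∀ {u w} → Consec (cycle x M) u w → u ≢ w) →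
                            MeetsOnceAt H (cycle x M) c₀ → deg H c₀ ≤ 2 → Profile H v E C →
                            Profile (H ++ [ cycle x M ]) v E (C ∪ (λ y → y₀ ≡ y × MeetsOnceAt H (cycle x M) v))
  Profile-++-pendantCycle {v} {c₀ = c₀} y₀ loopless once@(_ , c₀∈H , only) d≤2 pr with v ∈? cycle x M
  ... | no v∉c = Profile-≐ ≐-refl (≐-∪-Empty (λ _ → v∉c ∘ proj₁ ∘ proj₂)) (Profile-++-∉ v∉c pr)
  ... | yes v∈c with v ≟ c₀
  ...   | yes refl =
    Profile-≐ ≐-refl (Sum.map₂ (_, once) , Sum.map₂ proj₁)
      (Profile-++-centre y₀ c₀∈H d≤2 (EarDegree-cycle unique long v∈c) fresh pr)
    where
    fresh : ∀ {u} → Adj (cycle x M) v u → ¬ EdgeH H v u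
    fresh adj vu∈H with only _ (Adj-∈ (Adj-sym adj)) (EdgeH⇒VtxH H (EdgeH-sym H vu∈H))
    fresh (inj₁ c) _ | refl = loopless c refl
    fresh (inj₂ c) _ | refl = loopless c refl
  ...   | no v≢c₀ =
    Profile-≐ ≐-refl (≐-∪-Empty (λ _ → v∉H ∘ proj₁ ∘ proj₂ ∘ proj₂))
      (Profile-++-new v∈c v∉H (EarDegree-cycle unique long v∈c) pr)
    where v∉H : ¬ VtxH H v
          v∉H = v≢c₀ ∘ only v v∈c

  Profile-++-cycleOutside : ∀ {v} {E : Pred A 0ℓ} {C : Pred B 0ℓ} → All (λ u → ¬ VtxH H u) (cycle x M) →
                            Profile H v E C → Profile (H ++ [ cycle x M ]) v E C
  Profile-++-cycleOutside {v} outside pr with v ∈? cycle x M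
  ... | no v∉c  = Profile-++-∉ v∉c pr
  ... | yes v∈c = Profile-++-new v∈c (All.lookup outside v∈c) (EarDegree-cycle unique long v∈c) pr

-- Cycles meeting H

VtxH? : ∀ {n} (H : List (Ear n)) → Decidable (VtxH H)
VtxH? H v = Any.any? (v ∈?_) H

meetsOnce? : ∀ {n} (H : List (Ear n)) c → ∃ (MeetsOnceAt H c) ⊎ (∀ x → ¬ MeetsOnceAt H c x)
meetsOnce? H c with Any.any? (VtxH? H) c
... | no noneInH = inj₂ (λ x (x∈c , x∈H , _) → noneInH (lose x∈c x∈H))
... | yes someInH with find someInH
...   | x , x∈c , x∈H with All.all? (λ y → VtxH? H y →-dec y ≟ x) c
...     | yes onlyX = inj₁ (x , x∈c , x∈H , λ y y∈c → All.lookup onlyX y∈c)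
...     | no ¬onlyX = inj₂ λ x′ (_ , _ , only′) →
            ¬onlyX (All.tabulate λ {y} y∈c y∈H → trans (only′ y y∈c y∈H) (sym (only′ x x∈c x∈H)))

module _ {n : ℕ} (Γ : GView n) (H : List (Ear n)) where

  edge-HPath : ∀ {u w} → VtxH H u → VtxH H w → Vtx Γ u → Vtx Γ w → Edg Γ u w → u ≢ w → ¬ EdgeH H u w →
               HPath Γ H u w (u ∷ w ∷ [])
  edge-HPath u∈H w∈H u∈Γ w∈Γ uw∈Γ u≢w uw∉H =
    (All.tabulate (λ { (here refl) → u≢w ; (there ()) }) ∷ [] ∷ [] ,
     u∈Γ ∷ w∈Γ ∷ [] ,
     λ { here → uw∈Γ ; (there (there ())) }) ,
    [] , refl , u∈H , w∈H , [] , λ { here → uw∉H ; (there (there ())) }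

  -- Walk on from the exit edge u w to the first vertex b of H: u w … b is an H-path,
  -- unless the walk gets back to u without meeting H.
  exit-HPath-or-meetsOnce : ∀ {u w R} → Unique (u ∷ w ∷ R) → All (Vtx Γ) (cycle u (w ∷ R)) →
                            (∀ {s t} → Consec (cycle u (w ∷ R)) s t → Edg Γ s t) → VtxH H u → ¬ VtxH H w →
                            (∃₂ λ a b → ∃ (HPath Γ H a b)) ⊎ MeetsOnceAt H (cycle u (w ∷ R)) u
  exit-HPath-or-meetsOnce {u} {w} {R} unique vertices edges u∈H w∉H
    with First.first (λ v → Sum.swap (toSum (VtxH? H v))) R
  ... | inj₂ allOutside = inj₂ (here refl , u∈H , only)
    where
    only : ∀ y → y ∈ cycle u (w ∷ R) → VtxH H y → y ≡ u
    only y y∈ y∈H with to (∈-cycle (w ∷ R)) y∈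
    ... | here y≡u          = y≡u
    ... | there (here refl) = ⊥-elim (w∉H y∈H)
    ... | there (there y∈R) = ⊥-elim (All.lookup allOutside y∈R y∈H)
  ... | inj₁ firstInside with First.toView firstInside
  ...   | First._++_∷_ {N} {b} N∉H b∈H K =
    inj₁ (u , b , p , (p-unique , All.tabulate (All.lookup vertices ∘ p⊆cycle) , edges ∘ p-Consec⊆cycle) ,
          w ∷ N , refl , u∈H , b∈H , w∉H ∷ N∉H , inner∉H ∘ Consec-inner)
    where
    p : Ear n
    p = u ∷ (w ∷ N) ++ [ b ]
    split : cycle u (w ∷ N ++ b ∷ K) ≡ p ++ K ++ [ u ]
    split = cong (λ l → u ∷ w ∷ l) (trans (++-assoc N (b ∷ K) [ u ]) (sym (++-assoc N [ b ] (K ++ [ u ]))))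
    p⊆cycle : ∀ {s} → s ∈ p → s ∈ cycle u (w ∷ N ++ b ∷ K)
    p⊆cycle {s} = subst (s ∈_) (sym split) ∘ ∈-++⁺ˡ
    p-Consec⊆cycle : ∀ {s t} → Consec p s t → Consec (cycle u (w ∷ N ++ b ∷ K)) s t
    p-Consec⊆cycle {s} {t} = subst (λ l → Consec l s t) (sym split) ∘ Consec-++⁺ˡ (K ++ [ u ])
    p-unique : Unique p
    p-unique = Unique-++⁻ˡ p (subst Unique (cong (λ l → u ∷ w ∷ l) (sym (++-assoc N [ b ] K))) unique)
    inner∉H : ∀ {s t} → s ∈ w ∷ N ⊎ t ∈ w ∷ N → ¬ EdgeH H s t
    inner∉H (inj₁ s∈) st∈H = All.lookup (w∉H ∷ N∉H) s∈ (EdgeH⇒VtxH H st∈H)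
    inner∉H (inj₂ t∈) st∈H = All.lookup (w∉H ∷ N∉H) t∈ (EdgeH⇒VtxH H (EdgeH-sym H st∈H))

  cycle-HPath-or-meetsOnce : ∀ {x M} → Unique (x ∷ M) → All (Vtx Γ) (cycle x M) →
                             (∀ {u w} → Consec (cycle x M) u w → Edg Γ u w) →
                             ∀ {y z} → y ∈ cycle x M → VtxH H y → z ∈ cycle x M → ¬ VtxH H z →
                             (∃₂ λ a b → ∃ (HPath Γ H a b)) ⊎ ∃ (MeetsOnceAt H (cycle x M))
  cycle-HPath-or-meetsOnce {x} {M} unique vertices edges y∈ y∈H z∈ z∉H
    with cycle-transition (VtxH? H) y∈ y∈H z∈ z∉H
  ... | u , w , uw , u∈H , w∉H = fromRotation (rotate (to (∈-cycle M) (Consec-∈ˡ uw)))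
    where
    fromRotation : Rotation x M u → (∃₂ λ a b → ∃ (HPath Γ H a b)) ⊎ ∃ (MeetsOnceAt H (cycle x M))
    fromRotation r@(rotation _ _ consec⇔)
      with cycle-successor (Uniqueₚ.Unique[x∷xs]⇒x∉xs (Rotation-Unique r unique)) (λ { refl → w∉H u∈H })
                           (from consec⇔ uw)
    ... | R , refl =
      Sum.map₂ meetsOnce
        (exit-HPath-or-meetsOnce (Rotation-Unique r unique) (All.tabulate (All.lookup vertices ∘ to (Rotation-∈ r)))
                                 (edges ∘ to consec⇔) u∈H w∉H)
      where meetsOnce : MeetsOnceAt H (cycle u (w ∷ R)) u → ∃ (MeetsOnceAt H (cycle x M))
            meetsOnce (u∈ , u∈H , only) =
              u , to (Rotation-∈ r) u∈ , u∈H , λ y → only y ∘ from (Rotation-∈ r)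

  cycle-outside-or-inside : ∀ {c} → IsCycle Γ c → (∀ {u w} → Edg Γ u w → u ≢ w) →
                            (∀ a b p → ¬ HPath Γ H a b p) → (∀ x → ¬ MeetsOnceAt H c x) →
                            All (λ u → ¬ VtxH H u) c ⊎ (All (VtxH H) c × (∀ {u w} → Consec c u w → EdgeH H u w))
  cycle-outside-or-inside {c} (x , M , refl , _ , unique , vertices , edges) loopless noPath noMeet
    with All.all? (¬? ∘ VtxH? H) c | All.all? (VtxH? H) c
  ... | yes outside | _          = inj₁ outside
  ... | no _        | yes inside = inj₂ (inside , covered)
    where
    covered : ∀ {u w} → Consec c u w → EdgeH H u w
    covered {u} {w} uw = decidable-stable (T? _) λ uw∉H →
      noPath u w _ (edge-HPath (All.lookup inside (Consec-∈ˡ uw)) (All.lookup inside (Consec-∈ʳ uw))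
        (All.lookup vertices (Consec-∈ˡ uw)) (All.lookup vertices (Consec-∈ʳ uw))
        (edges uw) (loopless (edges uw)) uw∉H)
  ... | no ¬outside | no ¬inside
    with find (Allₚ.¬All⇒Any¬ (¬? ∘ VtxH? H) c ¬outside) | find (Allₚ.¬All⇒Any¬ (VtxH? H) c ¬inside)
  ...   | y , y∈ , ¬¬y∈H | z , z∈ , z∉H
    with cycle-HPath-or-meetsOnce unique vertices edges y∈ (decidable-stable (VtxH? H y) ¬¬y∈H) z∈ z∉H
  ...     | inj₁ (a , b , p , path) = ⊥-elim (noPath a b p path)
  ...     | inj₂ (x′ , once)        = ⊥-elim (noMeet x′ once)

-- Ears in G − Z

module _ {n : ℕ} (G : Graph n) where

  minus-loopless : ∀ {X : Fin n → Set} {u w} → Edg (G minus X) u w → u ≢ w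
  minus-loopless {u = u} (uw , _) refl = subst T (irrefl G u) uw

  deg≤2-outsideZ : ∀ H {a} → VtxH H a → ¬ Zset G H a → deg H a ≤ 2
  deg≤2-outsideZ H {a} a∈H a∉Z = ℕ.≮⇒≥ λ 3≤deg →
    a∉Z (a , a∈Y 3≤deg , 0 , z≤n , nil (λ (_ , a∉Y) → a∉Y (a∈Y 3≤deg)))
    where a∈Y : 3 ≤ deg H a → Yset H a
          a∈Y 3≤deg = a , 3≤deg , 0 , z≤n , nil a∈H

  module _ (X : Fin n → Set) where

    open import Data.List.Relation.Unary.Unique.DecPropositional (_≟_ {n}) using (unique?)

    private
      cycle-injective : ∀ {x x′ : Fin n} {K mid} → cycle x K ≡ cycle x′ mid → x ≡ x′ × K ≡ mid
      cycle-injective {K = K} {mid} e with ∷-injective e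
      ... | refl , e′ = refl , proj₁ (∷ʳ-injective K mid e′)

      shape : ∀ {x K} → IsCycle (G minus X) (cycle x K) → 2 ≤ length K × Unique (x ∷ K)
      shape (_ , _ , e , long , unique , _) with cycle-injective e
      ... | refl , refl = long , unique

      Edg-stable : ∀ {u w} → Stable (Edg (G minus X) u w)
      Edg-stable ¬¬uw = decidable-stable (T? _) (¬¬-map proj₁ ¬¬uw) ,
                        negated-stable (¬¬-map (proj₁ ∘ proj₂) ¬¬uw) ,
                        negated-stable (¬¬-map (proj₂ ∘ proj₂) ¬¬uw)

    IsCycle-stable : ∀ c → Stable (IsCycle (G minus X) c)
    IsCycle-stable c ¬¬cyc with initLast c
    ... | [] = ⊥-elim (¬¬cyc λ { (_ , _ , () , _) })
    ... | [] ∷ʳ′ y = ⊥-elim (¬¬cyc λ { (_ , mid , e , _) → []≢∷ʳ mid (proj₂ (∷-injective e)) })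
      where []≢∷ʳ : ∀ mid {x : Fin n} → [] ≢ mid ++ [ x ]
            []≢∷ʳ []      ()
            []≢∷ʳ (_ ∷ _) ()
    ... | (x ∷ K) ∷ʳ′ y with x ≟ y
    ...   | no x≢y = ⊥-elim (¬¬cyc λ { (_ , mid , e , _) →
      x≢y (trans (proj₁ (∷-injective e)) (sym (proj₂ (∷ʳ-injective K mid (proj₂ (∷-injective e)))))) })
    ...   | yes refl =
      x , K , refl ,
      decidable-stable (2 ℕ.≤? length K) (¬¬-map (proj₁ ∘ shape) ¬¬cyc) ,
      decidable-stable (unique? (x ∷ K)) (¬¬-map (proj₂ ∘ shape) ¬¬cyc) ,
      All.tabulate (λ u∈ →
        negated-stable (¬¬-map (λ (_ , _ , _ , _ , _ , vertices , _) → All.lookup vertices u∈) ¬¬cyc)) ,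
      λ uw → Edg-stable (¬¬-map (λ (_ , _ , _ , _ , _ , _ , edges) → edges uw) ¬¬cyc)

  module _ {A B : Set} (H : List (Ear n)) where

    Profile-++-HPath : ∀ {a b p v} {E : Pred A 0ℓ} {C : Pred B 0ℓ} x₀ → HPath (G minus Zset G H) H a b p →
                       Profile H v E C → Profile (H ++ [ p ]) v (E ∪ (λ x → x₀ ≡ x × IsEnd p v)) C
    Profile-++-HPath x₀ ((unique , vertices , _) , mid , refl , a∈H , b∈H , mid∉H , edges∉H) =
      Profile-++-path unique a∈H b∈H
        (deg≤2-outsideZ H a∈H (All.lookup vertices (here refl)))
        (deg≤2-outsideZ H b∈H (All.lookup vertices (there (∈-++⁺ʳ mid (here refl)))))
        mid∉H edges∉H x₀

    Profile-++-type1 : ∀ {c c₀ v} {E : Pred A 0ℓ} {C : Pred B 0ℓ} y₀ → IsCycle (G minus Zset G H) c →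
                       MeetsOnceAt H c c₀ → Profile H v E C →
                       Profile (H ++ [ c ]) v E (C ∪ (λ y → y₀ ≡ y × MeetsOnceAt H c v))
    Profile-++-type1 y₀ (_ , _ , refl , long , unique , vertices , edges) once@(c₀∈ , c₀∈H , _) =
      Profile-++-pendantCycle unique long y₀ (minus-loopless ∘ edges) once
        (deg≤2-outsideZ H c₀∈H (All.lookup vertices c₀∈))

    Profile-++-type2 : ∀ {c v} {E : Pred A 0ℓ} {C : Pred B 0ℓ} → IsCycle (G minus Zset G H) c →
                       (∀ a b p → ¬ HPath (G minus Zset G H) H a b p) → (∀ x → ¬ MeetsOnceAt H c x) →
                       Profile H v E C → Profile (H ++ [ c ]) v E C
    Profile-++-type2 cyc@(_ , _ , refl , long , unique , _) noPath noMeet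
      with cycle-outside-or-inside (G minus Zset G H) H cyc minus-loopless noPath noMeet
    ... | inj₁ outside            = Profile-++-cycleOutside unique long outside
    ... | inj₂ (inside , covered) = Profile-++-inside inside covered

-- Stages of the decomposition

_≤ₗ_ : ℕ × ℕ → ℕ × ℕ → Set
_≤ₗ_ = ×-Lex _≡_ _<_ _≤_

-- The events Ev up to position p in the order in which the ears P i j are added,
-- that is, lexicographically in (i , j); pos x is the position of the event x.
Upto : ∀ {X : Set} → Pred X 0ℓ → (X → ℕ × ℕ) → ℕ × ℕ → Pred X 0ℓ
Upto Ev pos p x = Ev x × pos x ≤ₗ p

module _ {X : Set} {Ev : Pred X 0ℓ} {pos : X → ℕ × ℕ} where

  Upto-suc : ∀ i j → Upto Ev pos (i , suc j) ≐ (Upto Ev pos (i , j) ∪ (λ x → (i , suc j) ≡ pos x × Ev x))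
  Upto-suc i j = to′ , from′
    where
    to′ : Upto Ev pos (i , suc j) ⊆ (Upto Ev pos (i , j) ∪ (λ x → (i , suc j) ≡ pos x × Ev x))
    to′ (Ex , inj₁ lt) = inj₁ (Ex , inj₁ lt)
    to′ (Ex , inj₂ (e₁ , le)) with ℕ.m≤n⇒m<n∨m≡n le
    ... | inj₁ lt = inj₁ (Ex , inj₂ (e₁ , ℕ.≤-pred lt))
    ... | inj₂ e₂ = inj₂ (cong₂ _,_ (sym e₁) (sym e₂) , Ex)
    from′ : (Upto Ev pos (i , j) ∪ (λ x → (i , suc j) ≡ pos x × Ev x)) ⊆ Upto Ev pos (i , suc j)
    from′ (inj₁ (Ex , inj₁ lt))       = Ex , inj₁ lt
    from′ (inj₁ (Ex , inj₂ (e , le))) = Ex , inj₂ (e , ℕ.m≤n⇒m≤1+n le)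
    from′ (inj₂ (p≡ , Ex)) rewrite sym p≡ = Ex , inj₂ (refl , ℕ.≤-refl)

  Upto-suc-new : ∀ {i j} {N : Pred X 0ℓ} → N ≐ (λ x → (i , suc j) ≡ pos x × Ev x) →
                 (Upto Ev pos (i , j) ∪ N) ≐ Upto Ev pos (i , suc j)
  Upto-suc-new {i} {j} (N⊆ , ⊆N) =
    proj₂ (Upto-suc i j) ∘ Sum.map₂ N⊆ , Sum.map₂ ⊆N ∘ proj₁ (Upto-suc i j)

  Upto-suc-none : ∀ {i j} → Empty (λ x → (i , suc j) ≡ pos x × Ev x) →
                  Upto Ev pos (i , j) ≐ Upto Ev pos (i , suc j)
  Upto-suc-none {i} {j} none = ≐-trans (≐-∪-Empty none) (≐-sym (Upto-suc i j))

  Upto-next : ∀ i k → (∀ {x} → Ev x → 1 ≤ proj₂ (pos x) × (proj₁ (pos x) ≡ i → proj₂ (pos x) ≤ k)) →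
              Upto Ev pos (suc i , 0) ≐ Upto Ev pos (i , k)
  Upto-next i k bounds = to′ , from′
    where
    to′ : Upto Ev pos (suc i , 0) ⊆ Upto Ev pos (i , k)
    to′ (Ex , inj₂ (_ , j≤0)) = ⊥-elim (ℕ.<-irrefl refl (ℕ.≤-trans (proj₁ (bounds Ex)) j≤0))
    to′ (Ex , inj₁ lt) with ℕ.m≤n⇒m<n∨m≡n (ℕ.≤-pred lt)
    ... | inj₁ lt′ = Ex , inj₁ lt′
    ... | inj₂ e   = Ex , inj₂ (e , proj₂ (bounds Ex) e)
    from′ : Upto Ev pos (i , k) ⊆ Upto Ev pos (suc i , 0)
    from′ (Ex , inj₁ lt)         = Ex , inj₁ (ℕ.m<n⇒m<1+n lt)
    from′ (Ex , inj₂ (refl , _)) = Ex , inj₁ ℕ.≤-refl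

  Upto-initial : (∀ {x} → Ev x → 1 ≤ proj₁ (pos x) × 1 ≤ proj₂ (pos x)) → Empty (Upto Ev pos (1 , 0))
  Upto-initial positive x (Ex , inj₁ lt)        = ℕ.<-irrefl refl (ℕ.≤-trans lt (proj₁ (positive Ex)))
  Upto-initial positive x (Ex , inj₂ (_ , j≤0)) = ℕ.<-irrefl refl (ℕ.≤-trans (proj₂ (positive Ex)) j≤0)

  Upto-all : ∀ t → (∀ {x} → Ev x → proj₁ (pos x) ≤ t) → Upto Ev pos (suc t , 0) ≐ Ev
  Upto-all t bound = proj₁ , λ Ex → Ex , inj₁ (s≤s (bound Ex))

range1-suc : ∀ j → range1 (suc j) ≡ range1 j ++ [ suc j ]
range1-suc j = trans (cong (map suc) (sym (upTo-∷ʳ j))) (map-++ suc (upTo j) [ j ])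

module _ {n : ℕ} (ℓ : ℕ → ℕ) (P : ℕ → ℕ → Ear n) where

  Hij-suc : ∀ i j → Hij ℓ P i (suc j) ≡ Hij ℓ P i j ++ [ P i (suc j) ]
  Hij-suc i j = begin
    Hbefore ℓ P i ++ map (P i) (range1 (suc j))
      ≡⟨ cong (λ r → Hbefore ℓ P i ++ map (P i) r) (range1-suc j) ⟩
    Hbefore ℓ P i ++ map (P i) (range1 j ++ [ suc j ])
      ≡⟨ cong (Hbefore ℓ P i ++_) (map-++ (P i) (range1 j) [ suc j ]) ⟩
    Hbefore ℓ P i ++ stage ℓ P i j ++ [ P i (suc j) ]
      ≡⟨ ++-assoc (Hbefore ℓ P i) (stage ℓ P i j) [ P i (suc j) ] ⟨
    Hij ℓ P i j ++ [ P i (suc j) ]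
      ∎
    where open ≡-Reasoning

  Hbefore-suc : ∀ i → Hbefore ℓ P (suc (suc i)) ≡ Hij ℓ P (suc i) (ℓ (suc i))
  Hbefore-suc i = begin
    concatMap stages (range1 (suc i))           ≡⟨ cong (concatMap stages) (range1-suc i) ⟩
    concatMap stages (range1 i ++ [ suc i ])    ≡⟨ concatMap-++ stages (range1 i) [ suc i ] ⟩
    Hbefore ℓ P (suc i) ++ stages (suc i) ++ [] ≡⟨ cong (Hbefore ℓ P (suc i) ++_) (++-identityʳ _) ⟩
    Hij ℓ P (suc i) (ℓ (suc i))                 ∎
    where
    open ≡-Reasoning
    stages : ℕ → List (Ear n)
    stages p = stage ℓ P p (ℓ p)

module _ {n : ℕ} {G : Graph n} {t : ℕ} {ℓ : ℕ → ℕ} {P : ℕ → ℕ → Ear n}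
         (D : IsCoarseEarDecomp G ℓ P t) (v : Fin n) where

  open IsCoarseEarDecomp D

  EndOf : Pred (ℕ × ℕ) 0ℓ
  EndOf ij = 1 ≤ proj₁ ij × proj₁ ij ≤ t × 2 ≤ proj₂ ij × proj₂ ij ≤ ℓ (proj₁ ij)
             × IsEnd (P (proj₁ ij) (proj₂ ij)) v

  CentreOf : Pred ℕ 0ℓ
  CentreOf i = 1 ≤ i × i ≤ t × Type1 G ℓ P i × IsC G ℓ P i v

  ProfileUpto : List (Ear n) → ℕ × ℕ → Set
  ProfileUpto H p = Profile H v (Upto EndOf id p) (Upto CentreOf (_, 1) p)

  ProfileAt : ℕ → ℕ → Set
  ProfileAt i j = ProfileUpto (Hij ℓ P i j) (i , j)

  ProfileBefore : ℕ → Set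
  ProfileBefore i = ProfileUpto (Hbefore ℓ P i) (i , 0)

  profile-initial : ProfileBefore 1
  profile-initial = absent (λ ())
    (Upto-initial (λ (i≥1 , _ , j≥2 , _) → i≥1 , ℕ.≤-trans (s≤s z≤n) j≥2))
    (Upto-initial (λ (i≥1 , _) → i≥1 , ℕ.≤-refl))

  -- Whether P i 1 is of type 1 cannot be decided, so we decide instead whether it
  -- meets H in a single vertex.  In that case (B) only shows that P i 1 is not not a
  -- cycle, which suffices because being a cycle of G − Z is ¬¬-stable.
  profile-firstEar : ∀ {i} → 1 ≤ i → i ≤ t → ProfileBefore i → ProfileAt i 1
  profile-firstEar {i} i≥1 i≤t pr with meetsOnce? (Hbefore ℓ P i) (P i 1)
  ... | inj₁ (c₀ , once) =
    Profile-≐ (Upto-suc-none noEnd)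
              (Upto-suc-new ((λ { (refl , isC) → refl , i≥1 , i≤t , type1 , isC }) ,
                             (λ { (refl , _ , _ , _ , isC) → refl , isC })))
      (Profile-++-type1 G (Hbefore ℓ P i) i isCycle once pr)
    where
    isCycle : IsCycle (Γbefore G ℓ P i) (P i 1)
    isCycle = IsCycle-stable G _ (P i 1) λ ¬cycle →
      ¬cycle (proj₁ (condB2 i i≥1 i≤t (λ type1 → ¬cycle (proj₁ (proj₂ (proj₁ (condB1 i i≥1 i≤t type1)))))))
    type1 : Type1 G ℓ P i
    type1 = P i 1 , c₀ , isCycle , once
    noEnd : Empty (λ x → (i , 1) ≡ x × EndOf x)
    noEnd _ (refl , _ , _ , s≤s () , _)
  ... | inj₂ noMeet =
    Profile-≐ (Upto-suc-none noEnd) (Upto-suc-none (λ { _ (refl , _ , _ , type1 , _) → ¬type1 type1 }))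
      (Profile-++-type2 G (Hbefore ℓ P i) (proj₁ (condB2 i i≥1 i≤t ¬type1)) (condA i i≥1 i≤t) noMeet pr)
    where
    ¬type1 : ¬ Type1 G ℓ P i
    ¬type1 type1 = noMeet _ (proj₂ (proj₂ (proj₁ (condB1 i i≥1 i≤t type1))))
    noEnd : Empty (λ x → (i , 1) ≡ x × EndOf x)
    noEnd _ (refl , _ , _ , s≤s () , _)

  profile-laterEar : ∀ {i j} → 1 ≤ i → i ≤ t → 1 ≤ j → suc j ≤ ℓ i → ProfileAt i j → ProfileAt i (suc j)
  profile-laterEar {i} {j} i≥1 i≤t j≥1 j<ℓ pr with proj₁ (condC i (suc j) i≥1 i≤t (s≤s j≥1) j<ℓ)
  ... | _ , _ , path =
    subst (λ H → ProfileUpto H (i , suc j)) (sym (Hij-suc ℓ P i j))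
      (Profile-≐ (Upto-suc-new ((λ { (refl , end) → refl , i≥1 , i≤t , s≤s j≥1 , j<ℓ , end }) ,
                                (λ { (refl , _ , _ , _ , _ , end) → refl , end })))
                 (Upto-suc-none (λ _ (≡y,1 , _) →
                    ℕ.<-irrefl refl (subst (1 ≤_) (ℕ.suc-injective (cong proj₂ ≡y,1)) j≥1)))
        (Profile-++-HPath G (Hij ℓ P i j) (i , suc j) path pr))

  profile-stage : ∀ {i} → 1 ≤ i → i ≤ t → ProfileBefore i → ∀ j → 1 ≤ j → j ≤ ℓ i → ProfileAt i j
  profile-stage i≥1 i≤t pr (suc zero)    _ _   = profile-firstEar i≥1 i≤t pr
  profile-stage i≥1 i≤t pr (suc (suc j)) _ j<ℓ =
    profile-laterEar i≥1 i≤t (s≤s z≤n) j<ℓ (profile-stage i≥1 i≤t pr (suc j) (s≤s z≤n) (ℕ.<⇒≤ j<ℓ))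

  profile-nextStage : ∀ i → suc i ≤ t → ProfileAt (suc i) (ℓ (suc i)) → ProfileBefore (suc (suc i))
  profile-nextStage i i<t pr =
    subst (λ H → ProfileUpto H (suc (suc i) , 0)) (sym (Hbefore-suc ℓ P i))
      (Profile-≐ (≐-sym (Upto-next (suc i) (ℓ (suc i)) endBounds))
                 (≐-sym (Upto-next (suc i) (ℓ (suc i)) centreBounds)) pr)
    where
    endBounds : ∀ {x} → EndOf x → 1 ≤ proj₂ x × (proj₁ x ≡ suc i → proj₂ x ≤ ℓ (suc i))
    endBounds {x} (_ , _ , j≥2 , j≤ℓ , _) =
      ℕ.≤-trans (s≤s z≤n) j≥2 , λ e → subst (λ k → proj₂ x ≤ ℓ k) e j≤ℓ
    centreBounds : ∀ {y} → CentreOf y → 1 ≤ 1 × (y ≡ suc i → 1 ≤ ℓ (suc i))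
    centreBounds (y≥1 , y≤t , _) = ℕ.≤-refl , λ { refl → ℓ-pos _ y≥1 y≤t }

  profile-upTo : ∀ k → k ≤ t → ProfileBefore (suc k)
  profile-upTo zero    _   = profile-initial
  profile-upTo (suc k) k<t = profile-nextStage k k<t
    (profile-stage (s≤s z≤n) k<t (profile-upTo k (ℕ.<⇒≤ k<t))
                   (ℓ (suc k)) (ℓ-pos (suc k) (s≤s z≤n) k<t) ℕ.≤-refl)

  profile-complete : Profile (Hbefore ℓ P (suc t)) v EndOf CentreOf
  profile-complete =
    Profile-≐ (Upto-all t (proj₁ ∘ proj₂)) (Upto-all t (proj₁ ∘ proj₂)) (profile-upTo t ℕ.≤-refl)

lemma3p2 : ∀ {n} (G : Graph n) (t : ℕ) (ℓ : ℕ → ℕ) (P : ℕ → ℕ → Ear n) →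
    IsCoarseEarDecomp G ℓ P t →
    ∀ v → VtxH (Hbefore ℓ P (suc t)) v →
      (deg (Hbefore ℓ P (suc t)) v ≡ 3 ⇔
         ∃! _≡_ (λ (ij : ℕ × ℕ) →
            1 ≤ proj₁ ij × proj₁ ij ≤ t × 2 ≤ proj₂ ij × proj₂ ij ≤ ℓ (proj₁ ij)
            × IsEnd (P (proj₁ ij) (proj₂ ij)) v))
      × (deg (Hbefore ℓ P (suc t)) v ≡ 4 ⇔
         ∃! _≡_ (λ (i : ℕ) → 1 ≤ i × i ≤ t × Type1 G ℓ P i × IsC G ℓ P i v))
lemma3p2 G t ℓ P D v v∈H = Profile-degree v∈H (profile-complete D v)
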